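{- For every integer $n\ge 2$, $p^n_{n;1}-p^{n-1}_{n;1}=p_{n-2}$.
   Context: Parking model: there are $n$ parking spaces in a line, numbered $1,\dots,n$. A preference set of length $n$ is a sequence $(a_1,\dots,a_n)$ of integers with $1\le a_i\le n$; cars $1,\dots,n$ arrive in order, car $i$ parks in the first unoccupied space numbered $\ge a_i$ if one exists, otherwise it fails to park. $p^l_{n;1}$ denotes the number of preference sets of length $n$ (with $n$ spaces) with exactly one car failing to park and $a_1=l$. $p_j$ denotes the number of parking functions (preference sets where all cars park) of length $j$ with $j$ spaces, $p_j=(j+1)^{j-1}$, and $p_0=1$. -}

module Defs where

open import Data.Nat using (ℕ; zero; suc; _+_; _*_; _∸_; _^_; _≡ᵇ_)
open import Data.Bool using (Bool; true; false; if_then_else_)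
open import Data.Fin using (Fin; zero; suc; toℕ)
open import Data.Vec using (Vec; []; _∷_; replicate; head)
open import Data.List using (List; []; _∷_; map; concatMap; length; filter)
open import Data.Product using (_×_; _,_; proj₁; proj₂)
open import Relation.Binary.PropositionalEquality using (_≡_)
open import Relation.Nullary.Decidable using (does)
open import Data.Nat using (_≟_)

-- Convention: spaces and preferences are 0-indexed; a value  a : Fin n
-- represents the paper's preference  toℕ a + 1 ∈ {1,…,n}.

-- Occupancy of the n spaces: true = occupied.
-- 'parkFrom a occ' : car with preference a (0-indexed, as ℕ) tries to park
-- in the first unoccupied space with index ≥ a.
parkFrom : {m : ℕ} → ℕ → Vec Bool m → Vec Bool m × Bool
parkFrom a [] = [] , false
parkFrom (suc a) (b ∷ occ) with parkFrom a occ
... | occ' , ok = (b ∷ occ') , ok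
parkFrom zero (false ∷ occ) = (true ∷ occ) , true
parkFrom zero (true ∷ occ) with parkFrom zero occ
... | occ' , ok = (true ∷ occ') , ok

failures : {n k : ℕ} → Vec Bool n → Vec (Fin n) k → ℕ
failures occ [] = 0
failures occ (a ∷ as) with parkFrom (toℕ a) occ
... | occ' , true  = failures occ' as
... | occ' , false = suc (failures occ' as)

numFail : {n k : ℕ} → Vec (Fin n) k → ℕ
numFail {n} as = failures (replicate n false) as

allFinL : (n : ℕ) → List (Fin n)
allFinL zero = []
allFinL (suc n) = zero ∷ map suc (allFinL n)

allVecs : (n k : ℕ) → List (Vec (Fin n) k)
allVecs n zero = [] ∷ []
allVecs n (suc k) = concatMap (λ a → map (a ∷_) (allVecs n k)) (allFinL n)

prefSetsStartingWith : {n : ℕ} → Fin n → List (Vec (Fin n) n)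
prefSetsStartingWith {zero} ()
prefSetsStartingWith {suc n} a = map (a ∷_) (allVecs (suc n) n)

-- p^l_{n;1} for  l = toℕ a + 1 : number of preference sets of length n with
-- exactly one car failing to park and a₁ = l.
pOne : (n : ℕ) → Fin n → ℕ
pOne n a = length (filter (λ v → numFail v ≟ 1) (prefSetsStartingWith a))

parkingFunctions : ℕ → ℕ
parkingFunctions j = length (filter (λ v → numFail v ≟ 0) (allVecs j j))

-- After the first car has parked in space n (resp. n - 1), the other n - 1 cars meet
-- n - 2 vacant spaces followed by vacant, occupied (resp. occupied, vacant). Following
-- the cars one at a time, a car heading for the last two spaces acts on the first n - 2
-- spaces like a marked car that is set aside, and the two counts with one failure differ
-- by Y - Q, where Y (resp. Q) counts sequences with one (resp. two) marked cars whose
-- other cars all park on the first n - 2 spaces: Y = (n - 1) Z(n - 2) and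
-- Q = C(n - 1, 2) Z(n - 3), with Z(k) the number of ways k cars all park on n - 2 spaces.
-- Pollak's circular argument (wrap around to space 1; then every space of the circle is
-- equally often left vacant) gives (n - 1) Z(k) = (n - 1 - k) (n - 1)^k, hence
-- Y - Q = Z(n - 2) = p_{n-2}.
module Submission where

open import Defs
open import Agda.Primitive using (lzero)
open import Data.Nat.Properties
open import Algebra.Properties.Semiring.Sum +-*-semiring
  using (sum-syntax; sum-cong-≗; ∑-distrib-+; ∑-comm; *-distribˡ-sum; sum-init-last)
open import Data.Bool using (Bool; true; false; not; if_then_else_)
open import Data.Fin using (Fin; zero; suc; toℕ; fromℕ; inject₁)
open import Data.Fin.Induction using (<-weakInduction)
open import Data.Fin.Properties using (toℕ-fromℕ; toℕ-inject₁; toℕ<n)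
open import Data.List using (List; []; _∷_; map; concatMap; length; filter; _++_)
open import Data.List.Properties using (filter-++; length-++; concatMap-map; filter-≐; filter-none)
open import Data.List.Relation.Unary.All using (universal)
open import Data.Nat using (ℕ; zero; suc; _+_; _*_; _∸_; _^_; _≤_; _<_; _≟_; z≤n; s≤s; _≤?_)
open import Data.Nat.Combinatorics using (_C_; nC1≡n; k>n⇒nCk≡0; nCk+nC[k+1]≡[n+1]C[k+1])
open import Data.Nat.Tactic.RingSolver using (solve-∀)
open import Data.Product using (_×_; _,_; proj₁; proj₂)
open import Data.Vec using (Vec; []; _∷_; _∷ʳ_; replicate; lookup)
open import Function using (_∘_)
open import Relation.Binary.PropositionalEquality
open import Relation.Nullary.Decidable using (does; yes; no)
open import Relation.Unary using (Pred; Decidable)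
open ≡-Reasoning

∑-const : ∀ n c → ∑[ i < n ] c ≡ n * c
∑-const zero    c = refl
∑-const (suc n) c = cong (c +_) (∑-const n c)

parkFrom-beyond : ∀ {n} (o : Vec Bool n) a → n ≤ a → parkFrom a o ≡ (o , false)
parkFrom-beyond []      a       _         = refl
parkFrom-beyond (b ∷ o) (suc a) (s≤s n≤a) rewrite parkFrom-beyond o a n≤a = refl

parkFrom-failure-unchanged : ∀ {n} a (o : Vec Bool n) → proj₂ (parkFrom a o) ≡ false → proj₁ (parkFrom a o) ≡ o
parkFrom-failure-unchanged a       []           _    = refl
parkFrom-failure-unchanged (suc a) (b ∷ o)      fail = cong (b ∷_) (parkFrom-failure-unchanged a o fail)
parkFrom-failure-unchanged zero    (true ∷ o)   fail = cong (true ∷_) (parkFrom-failure-unchanged zero o fail)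
parkFrom-failure-unchanged zero    (false ∷ o)  ()

snocOutcome : ∀ {l} → Vec Bool l → Bool → Vec Bool l × Bool → Vec Bool (suc l) × Bool
snocOutcome L b (L′ , true)  = L′ ∷ʳ b , true
snocOutcome L b (_  , false) = L ∷ʳ true , not b

parkFrom-∷ʳ : ∀ {l} a (L : Vec Bool l) b → a ≤ l → parkFrom a (L ∷ʳ b) ≡ snocOutcome L b (parkFrom a L)
parkFrom-∷ʳ zero    []          false _ = refl
parkFrom-∷ʳ zero    []          true  _ = refl
parkFrom-∷ʳ zero    (false ∷ L) b     _ = refl
parkFrom-∷ʳ zero    (true ∷ L)  b     _ rewrite parkFrom-∷ʳ zero L b z≤n with parkFrom zero L
... | _ , true  = refl
... | _ , false = refl
parkFrom-∷ʳ (suc a) (x ∷ L)     b (s≤s a≤l) rewrite parkFrom-∷ʳ a L b a≤l with parkFrom a L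
... | _ , true  = refl
... | _ , false = refl

-- Counting preference sequences

ifParked : ∀ {n} → (Vec Bool n → ℕ) → ℕ → Vec Bool n × Bool → ℕ
ifParked f g (o , true)  = f o
ifParked f g (_ , false) = g

nextCar : ∀ {n} → Vec Bool n → (Vec Bool n → ℕ) → ℕ → ℕ
nextCar {n} o f g = ∑[ a < n ] ifParked f g (parkFrom (toℕ a) o)

mutual
  failCount : ∀ {n} → Vec Bool n → ℕ → ℕ → ℕ
  failCount o zero    zero    = 1
  failCount o zero    (suc j) = 0
  failCount o (suc k) j       = nextCar o (λ o′ → failCount o′ k j) (failCountAfterFailure o k j)

  failCountAfterFailure : ∀ {n} → Vec Bool n → ℕ → ℕ → ℕ
  failCountAfterFailure o k zero    = 0
  failCountAfterFailure o k (suc j) = failCount o k j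

module _ {A : Set} {P : Pred A lzero} (P? : Decidable P) where

  length-filter-++ : ∀ xs ys → length (filter P? (xs ++ ys)) ≡ length (filter P? xs) + length (filter P? ys)
  length-filter-++ xs ys = trans (cong length (filter-++ P? xs ys)) (length-++ (filter P? xs))

  length-filter-map : ∀ {B : Set} (f : B → A) xs → length (filter P? (map f xs)) ≡ length (filter (P? ∘ f) xs)
  length-filter-map f []       = refl
  length-filter-map f (x ∷ xs) with does (P? (f x))
  ... | true  = cong suc (length-filter-map f xs)
  ... | false = length-filter-map f xs

  length-filter-concatMap-allFinL : ∀ n (f : Fin n → List A) →
    length (filter P? (concatMap f (allFinL n))) ≡ ∑[ a < n ] length (filter P? (f a))
  length-filter-concatMap-allFinL zero    f = refl
  length-filter-concatMap-allFinL (suc n) f = begin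
    length (filter P? (f zero ++ concatMap f (map suc (allFinL n))))
      ≡⟨ length-filter-++ (f zero) _ ⟩
    length (filter P? (f zero)) + length (filter P? (concatMap f (map suc (allFinL n))))
      ≡⟨ cong (λ xs → length (filter P? (f zero)) + length (filter P? xs)) (concatMap-map f suc (allFinL n)) ⟩
    length (filter P? (f zero)) + length (filter P? (concatMap (f ∘ suc) (allFinL n)))
      ≡⟨ cong (length (filter P? (f zero)) +_) (length-filter-concatMap-allFinL n (f ∘ suc)) ⟩
    ∑[ a < suc n ] length (filter P? (f a)) ∎

module _ {A : Set} (f : A → ℕ) (xs : List A) where

  length-filter-≡-cong : ∀ (g : A → ℕ) j → (∀ x → f x ≡ g x) →
    length (filter (λ x → f x ≟ j) xs) ≡ length (filter (λ x → g x ≟ j) xs)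
  length-filter-≡-cong g j f≗g = cong length (filter-≐ (λ x → f x ≟ j) (λ x → g x ≟ j)
    ((λ {x} p → trans (sym (f≗g x)) p) , (λ {x} q → trans (f≗g x) q)) xs)

  length-filter-suc-≡-suc : ∀ j → length (filter (λ x → suc (f x) ≟ suc j) xs) ≡ length (filter (λ x → f x ≟ j) xs)
  length-filter-suc-≡-suc j = cong length (filter-≐ (λ x → suc (f x) ≟ suc j) (λ x → f x ≟ j) (suc-injective , cong suc) xs)

  length-filter-suc-≡-zero : length (filter (λ x → suc (f x) ≟ 0) xs) ≡ 0
  length-filter-suc-≡-zero = cong length (filter-none (λ x → suc (f x) ≟ 0) (universal (λ x → 1+n≢0) xs))

failuresAfter : ∀ {n k} → Vec Bool n × Bool → Vec (Fin n) k → ℕ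
failuresAfter (o , true)  v = failures o v
failuresAfter (o , false) v = suc (failures o v)

failures-∷ : ∀ {n k} (o : Vec Bool n) a (v : Vec (Fin n) k) → failures o (a ∷ v) ≡ failuresAfter (parkFrom (toℕ a) o) v
failures-∷ o a v with parkFrom (toℕ a) o
... | _ , true  = refl
... | _ , false = refl

mutual
  #failing≡failCount : ∀ {n} (o : Vec Bool n) k j → length (filter (λ v → failures o v ≟ j) (allVecs n k)) ≡ failCount o k j
  #failing≡failCount     o zero    zero    = refl
  #failing≡failCount     o zero    (suc j) = refl
  #failing≡failCount {n} o (suc k) j       =
    trans (length-filter-concatMap-allFinL (λ v → failures o v ≟ j) n _) (sum-cong-≗ {n} (λ a → #failing-∷ o a k j))

  #failing-∷ : ∀ {n} (o : Vec Bool n) a k j →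
    length (filter (λ v → failures o v ≟ j) (map (a ∷_) (allVecs n k)))
      ≡ ifParked (λ o′ → failCount o′ k j) (failCountAfterFailure o k j) (parkFrom (toℕ a) o)
  #failing-∷ {n} o a k j = begin
    length (filter (λ v → failures o v ≟ j) (map (a ∷_) (allVecs n k)))
      ≡⟨ length-filter-map (λ v → failures o v ≟ j) (a ∷_) (allVecs n k) ⟩
    length (filter (λ v → failures o (a ∷ v) ≟ j) (allVecs n k))
      ≡⟨ length-filter-≡-cong (λ v → failures o (a ∷ v)) (allVecs n k) _ j (failures-∷ o a) ⟩
    length (filter (λ v → failuresAfter (parkFrom (toℕ a) o) v ≟ j) (allVecs n k))
      ≡⟨ afterFirstCar (parkFrom (toℕ a) o) (parkFrom-failure-unchanged (toℕ a) o) ⟩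
    ifParked (λ o′ → failCount o′ k j) (failCountAfterFailure o k j) (parkFrom (toℕ a) o) ∎
    where
    afterFirstCar : ∀ r → (proj₂ r ≡ false → proj₁ r ≡ o) →
      length (filter (λ v → failuresAfter r v ≟ j) (allVecs n k))
        ≡ ifParked (λ o′ → failCount o′ k j) (failCountAfterFailure o k j) r
    afterFirstCar (o′ , true)  _         = #failing≡failCount o′ k j
    afterFirstCar (o′ , false) unchanged with unchanged refl
    ... | refl = failed j
      where
      failed : ∀ j → length (filter (λ v → suc (failures o′ v) ≟ j) (allVecs n k)) ≡ failCountAfterFailure o′ k j
      failed zero    = length-filter-suc-≡-zero (failures o′) (allVecs n k)
      failed (suc j) = trans (length-filter-suc-≡-suc (failures o′) (allVecs n k) j) (#failing≡failCount o′ k j)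

module _ {n} (o : Vec Bool n) where

  nextCar-cong : ∀ {f f′ g g′} → (∀ x → f x ≡ f′ x) → g ≡ g′ → nextCar o f g ≡ nextCar o f′ g′
  nextCar-cong {f} {f′} {g} f≗f′ refl = sum-cong-≗ {n} (λ a → ifParked-cong (parkFrom (toℕ a) o))
    where
    ifParked-cong : ∀ p → ifParked f g p ≡ ifParked f′ g p
    ifParked-cong (x , true)  = f≗f′ x
    ifParked-cong (_ , false) = refl

  nextCar-+ : ∀ f f′ g g′ → nextCar o (λ x → f x + f′ x) (g + g′) ≡ nextCar o f g + nextCar o f′ g′
  nextCar-+ f f′ g g′ = trans (sum-cong-≗ {n} (λ a → ifParked-+ (parkFrom (toℕ a) o)))
    (∑-distrib-+ {n} (λ a → ifParked f g (parkFrom (toℕ a) o)) (λ a → ifParked f′ g′ (parkFrom (toℕ a) o)))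
    where
    ifParked-+ : ∀ p → ifParked (λ x → f x + f′ x) (g + g′) p ≡ ifParked f g p + ifParked f′ g′ p
    ifParked-+ (_ , true)  = refl
    ifParked-+ (_ , false) = refl

  nextCar-* : ∀ c f g → nextCar o (λ x → c * f x) (c * g) ≡ c * nextCar o f g
  nextCar-* c f g = trans (sum-cong-≗ {n} (λ a → ifParked-* (parkFrom (toℕ a) o)))
    (sym (*-distribˡ-sum {n} c (λ a → ifParked f g (parkFrom (toℕ a) o))))
    where
    ifParked-* : ∀ p → ifParked (λ x → c * f x) (c * g) p ≡ c * ifParked f g p
    ifParked-* (_ , true)  = refl
    ifParked-* (_ , false) = refl

nextCar-∷ʳ : ∀ {l} (L : Vec Bool l) b f g →
  let h = ifParked f g (L ∷ʳ true , not b) in nextCar (L ∷ʳ b) f g ≡ nextCar L (λ x → f (x ∷ʳ b)) h + h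
nextCar-∷ʳ {l} L b f g =
  trans (sum-init-last (λ a → ifParked f g (parkFrom (toℕ a) (L ∷ʳ b)))) (cong₂ _+_ (sum-cong-≗ {l} inner) last)
  where
  h = ifParked f g (L ∷ʳ true , not b)
  inner : ∀ a → ifParked f g (parkFrom (toℕ (inject₁ a)) (L ∷ʳ b)) ≡ ifParked (λ x → f (x ∷ʳ b)) h (parkFrom (toℕ a) L)
  inner a rewrite toℕ-inject₁ a | parkFrom-∷ʳ (toℕ a) L b (<⇒≤ (toℕ<n a)) with parkFrom (toℕ a) L
  ... | _ , true  = refl
  ... | _ , false = refl
  last : ifParked f g (parkFrom (toℕ (fromℕ l)) (L ∷ʳ b)) ≡ h
  last rewrite toℕ-fromℕ l | parkFrom-∷ʳ l L b ≤-refl | parkFrom-beyond L l ≤-refl = refl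

-- Marked cars

-- A marked car is set aside instead of parking: marked o k s counts the sequences of
-- k cars with s marked cars in which every unmarked car parks.
marked : ∀ {n} → Vec Bool n → ℕ → ℕ → ℕ
marked o k       zero    = failCount o k 0
marked o zero    (suc s) = 0
marked o (suc k) (suc s) = nextCar o (λ o′ → marked o′ k (suc s)) 0 + marked o k s

marked≡C*failCount : ∀ {n} (o : Vec Bool n) k s → marked o k s ≡ (k C s) * failCount o (k ∸ s) 0
marked≡C*failCount o k       zero    = sym (*-identityˡ (failCount o k 0))
marked≡C*failCount o zero    (suc s) = refl
marked≡C*failCount o (suc k) (suc s) = begin
  nextCar o (λ x → marked x k (suc s)) 0 + marked o k s
    ≡⟨ cong₂ _+_ (nextCar-cong o (λ x → marked≡C*failCount x k (suc s)) (sym (*-zeroʳ c)))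
                 (marked≡C*failCount o k s) ⟩
  nextCar o (λ x → c * failCount x (k ∸ suc s) 0) (c * 0) + (k C s) * Z
    ≡⟨ cong (_+ (k C s) * Z) (trans (nextCar-* o c (λ x → failCount x (k ∸ suc s) 0) 0) unfold) ⟩
  c * Z + (k C s) * Z
    ≡⟨ sym (*-distribʳ-+ Z c (k C s)) ⟩
  (c + k C s) * Z
    ≡⟨ cong (_* Z) (trans (+-comm c (k C s)) (nCk+nC[k+1]≡[n+1]C[k+1] k s)) ⟩
  (suc k C suc s) * Z ∎
  where
  c = k C suc s
  Z = failCount o (k ∸ s) 0
  unfold : c * failCount o (suc (k ∸ suc s)) 0 ≡ c * Z
  unfold with suc s ≤? k
  ... | yes s<k = cong (λ m → c * failCount o m 0) (sym (+-∸-assoc 1 s<k))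
  ... | no  s≮k = trans (cong (_* failCount o (suc (k ∸ suc s)) 0) c≡0) (cong (_* Z) (sym c≡0))
    where c≡0 = k>n⇒nCk≡0 (≰⇒> s≮k)

marked-∷ʳ-occupied : ∀ {l} (L : Vec Bool l) k s → marked (L ∷ʳ true) k s ≡ marked L k s
marked-∷ʳ-occupied L zero    zero    = refl
marked-∷ʳ-occupied L zero    (suc s) = refl
marked-∷ʳ-occupied L (suc k) zero    =
  trans (nextCar-∷ʳ L true _ 0) (trans (+-identityʳ _) (nextCar-cong L (λ x → marked-∷ʳ-occupied x k 0) refl))
marked-∷ʳ-occupied L (suc k) (suc s) = cong₂ _+_
  (trans (nextCar-∷ʳ L true _ 0) (trans (+-identityʳ _) (nextCar-cong L (λ x → marked-∷ʳ-occupied x k (suc s)) refl)))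
  (marked-∷ʳ-occupied L k s)

failCount-∷ʳ-occupied₁ : ∀ {l} (L : Vec Bool l) k → failCount (L ∷ʳ true) k 1 ≡ failCount L k 1 + marked L k 1
failCount-∷ʳ-occupied₁ L zero    = refl
failCount-∷ʳ-occupied₁ L (suc k) = begin
  nextCar (L ∷ʳ true) (λ x → failCount x k 1) (failCount (L ∷ʳ true) k 0)
    ≡⟨ nextCar-∷ʳ L true _ _ ⟩
  nextCar L (λ x → failCount (x ∷ʳ true) k 1) (failCount (L ∷ʳ true) k 0) + failCount (L ∷ʳ true) k 0
    ≡⟨ cong₂ _+_ (nextCar-cong L (λ x → failCount-∷ʳ-occupied₁ x k) (trans Z-eq (sym (+-identityʳ _)))) Z-eq ⟩
  nextCar L (λ x → failCount x k 1 + marked x k 1) (failCount L k 0 + 0) + failCount L k 0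
    ≡⟨ cong (_+ failCount L k 0) (nextCar-+ L _ _ _ _) ⟩
  nextCar L (λ x → failCount x k 1) (failCount L k 0) + nextCar L (λ x → marked x k 1) 0 + failCount L k 0
    ≡⟨ +-assoc (failCount L (suc k) 1) (nextCar L (λ x → marked x k 1) 0) (failCount L k 0) ⟩
  failCount L (suc k) 1 + marked L (suc k) 1 ∎
  where Z-eq = marked-∷ʳ-occupied L k 0

failCount-∷ʳ-vacant₀ : ∀ {l} (L : Vec Bool l) k →
  failCount (L ∷ʳ false) k 0 ≡ failCount L k 0 + failCount L k 1 + marked L k 1
failCount-∷ʳ-vacant₀ L zero    = refl
failCount-∷ʳ-vacant₀ L (suc k) = begin
  nextCar (L ∷ʳ false) (λ x → failCount x k 0) 0
    ≡⟨ nextCar-∷ʳ L false _ 0 ⟩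
  nextCar L (λ x → failCount (x ∷ʳ false) k 0) (failCount (L ∷ʳ true) k 0) + failCount (L ∷ʳ true) k 0
    ≡⟨ cong₂ _+_ (nextCar-cong L (λ x → failCount-∷ʳ-vacant₀ x k) (trans Z-eq (sym (+-identityʳ _)))) Z-eq ⟩
  nextCar L (λ x → failCount x k 0 + failCount x k 1 + marked x k 1) (0 + failCount L k 0 + 0) + failCount L k 0
    ≡⟨ cong (_+ failCount L k 0) (trans (nextCar-+ L _ _ _ _) (cong (_+ nextCar L (λ x → marked x k 1) 0) (nextCar-+ L _ _ _ _))) ⟩
  failCount L (suc k) 0 + failCount L (suc k) 1 + nextCar L (λ x → marked x k 1) 0 + failCount L k 0
    ≡⟨ +-assoc (failCount L (suc k) 0 + failCount L (suc k) 1) (nextCar L (λ x → marked x k 1) 0) (failCount L k 0) ⟩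
  failCount L (suc k) 0 + failCount L (suc k) 1 + marked L (suc k) 1 ∎
  where Z-eq = marked-∷ʳ-occupied L k 0

failCount-vacant-occupied₀-balance : ∀ {l} (L : Vec Bool l) k →
  failCount (L ∷ʳ false ∷ʳ true) k 0 + marked L k 1 ≡ failCount (L ∷ʳ true ∷ʳ true) k 1 + failCount L k 0
failCount-vacant-occupied₀-balance L k = begin
  failCount (L ∷ʳ false ∷ʳ true) k 0 + marked L k 1
    ≡⟨ cong (_+ marked L k 1) (trans (marked-∷ʳ-occupied (L ∷ʳ false) k 0) (failCount-∷ʳ-vacant₀ L k)) ⟩
  failCount L k 0 + failCount L k 1 + marked L k 1 + marked L k 1
    ≡⟨ rearrange (failCount L k 0) (failCount L k 1) (marked L k 1) ⟩
  failCount L k 1 + marked L k 1 + marked L k 1 + failCount L k 0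
    ≡⟨ cong (_+ failCount L k 0) occupied² ⟨
  failCount (L ∷ʳ true ∷ʳ true) k 1 + failCount L k 0 ∎
  where
  rearrange : ∀ z w m → z + w + m + m ≡ w + m + m + z
  rearrange = solve-∀
  occupied² : failCount (L ∷ʳ true ∷ʳ true) k 1 ≡ failCount L k 1 + marked L k 1 + marked L k 1
  occupied² = trans (failCount-∷ʳ-occupied₁ (L ∷ʳ true) k)
                    (cong₂ _+_ (failCount-∷ʳ-occupied₁ L k) (marked-∷ʳ-occupied L k 1))

failCount-swap-last-two₁ : ∀ {l} (L : Vec Bool l) k →
  failCount (L ∷ʳ false ∷ʳ true) k 1 + marked L k 2 ≡ failCount (L ∷ʳ true ∷ʳ false) k 1 + marked L k 1
failCount-swap-last-two₁     L zero    = refl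
failCount-swap-last-two₁ {l} L (suc k) = begin
  failCount (L ∷ʳ false ∷ʳ true) (suc k) 1 + marked L (suc k) 2
    ≡⟨ cong (_+ marked L (suc k) 2) unfold-FT ⟩
  nextCar L FT d + d + c + (nextCar L (λ x → marked x k 2) 0 + marked L k 1)
    ≡⟨ regroup (nextCar L FT d) (nextCar L (λ x → marked x k 2) 0) d c (marked L k 1) ⟩
  (nextCar L FT d + nextCar L (λ x → marked x k 2) 0) + d + (c + marked L k 1)
    ≡⟨ cong₂ (λ u v → u + d + v) ih (failCount-vacant-occupied₀-balance L k) ⟩
  (nextCar L TF d + nextCar L (λ x → marked x k 1) 0) + d + (d + failCount L k 0)
    ≡⟨ sym (regroup (nextCar L TF d) (nextCar L (λ x → marked x k 1) 0) d d (failCount L k 0)) ⟩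
  nextCar L TF d + d + d + (nextCar L (λ x → marked x k 1) 0 + failCount L k 0)
    ≡⟨ cong (_+ marked L (suc k) 1) (sym unfold-TF) ⟩
  failCount (L ∷ʳ true ∷ʳ false) (suc k) 1 + marked L (suc k) 1 ∎
  where
  FT TF : Vec Bool l → ℕ
  FT x = failCount (x ∷ʳ false ∷ʳ true) k 1
  TF x = failCount (x ∷ʳ true ∷ʳ false) k 1
  c = failCount (L ∷ʳ false ∷ʳ true) k 0
  d = failCount (L ∷ʳ true ∷ʳ true) k 1

  regroup : ∀ a b d c e → a + d + c + (b + e) ≡ (a + b) + d + (c + e)
  regroup = solve-∀

  unfold-FT : failCount (L ∷ʳ false ∷ʳ true) (suc k) 1 ≡ nextCar L FT d + d + c
  unfold-FT = trans (nextCar-∷ʳ (L ∷ʳ false) true _ c) (cong (_+ c) (nextCar-∷ʳ L false _ c))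

  unfold-TF : failCount (L ∷ʳ true ∷ʳ false) (suc k) 1 ≡ nextCar L TF d + d + d
  unfold-TF = trans (nextCar-∷ʳ (L ∷ʳ true) false _ _) (cong (_+ d) (nextCar-∷ʳ L true _ d))

  ih : nextCar L FT d + nextCar L (λ x → marked x k 2) 0 ≡ nextCar L TF d + nextCar L (λ x → marked x k 1) 0
  ih = begin
    nextCar L FT d + nextCar L (λ x → marked x k 2) 0
      ≡⟨ sym (nextCar-+ L FT (λ x → marked x k 2) d 0) ⟩
    nextCar L (λ x → FT x + marked x k 2) (d + 0)
      ≡⟨ nextCar-cong L (λ x → failCount-swap-last-two₁ x k) refl ⟩
    nextCar L (λ x → TF x + marked x k 1) (d + 0)
      ≡⟨ nextCar-+ L TF (λ x → marked x k 1) d 0 ⟩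
    nextCar L TF d + nextCar L (λ x → marked x k 1) 0 ∎


-- Circular parking

vacancy : Bool → ℕ
vacancy false = 1
vacancy true  = 0

vacancies : ∀ {n} → Vec Bool n → ℕ
vacancies {n} o = ∑[ r < n ] vacancy (lookup o r)

parkFrom-success-vacancies : ∀ {n} a (o : Vec Bool n) → proj₂ (parkFrom a o) ≡ true →
  suc (vacancies (proj₁ (parkFrom a o))) ≡ vacancies o
parkFrom-success-vacancies (suc a) (b ∷ o)     ok =
  trans (sym (+-suc (vacancy b) _)) (cong (vacancy b +_) (parkFrom-success-vacancies a o ok))
parkFrom-success-vacancies zero    (false ∷ o) ok = refl
parkFrom-success-vacancies zero    (true ∷ o)  ok = parkFrom-success-vacancies zero o ok

parkFrom-zero-failure-full : ∀ {n} (o : Vec Bool n) → proj₂ (parkFrom 0 o) ≡ false → vacancies o ≡ 0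
parkFrom-zero-failure-full []         _    = refl
parkFrom-zero-failure-full (true ∷ o) fail = parkFrom-zero-failure-full o fail
parkFrom-zero-failure-full (false ∷ o) ()

parkFrom-keeps-occupied : ∀ {n} a (o : Vec Bool n) r → lookup o r ≡ true → lookup (proj₁ (parkFrom a o)) r ≡ true
parkFrom-keeps-occupied (suc a) (b ∷ o)     zero    occ = occ
parkFrom-keeps-occupied (suc a) (b ∷ o)     (suc r) occ = parkFrom-keeps-occupied a o r occ
parkFrom-keeps-occupied zero    (false ∷ o) zero    occ = refl
parkFrom-keeps-occupied zero    (false ∷ o) (suc r) occ = occ
parkFrom-keeps-occupied zero    (true ∷ o)  zero    occ = refl
parkFrom-keeps-occupied zero    (true ∷ o)  (suc r) occ = parkFrom-keeps-occupied zero o r occ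

lookup-∷ʳ-inject₁ : ∀ {A : Set} {m} (o : Vec A m) x r → lookup (o ∷ʳ x) (inject₁ r) ≡ lookup o r
lookup-∷ʳ-inject₁ (y ∷ o) x zero    = refl
lookup-∷ʳ-inject₁ (y ∷ o) x (suc r) = lookup-∷ʳ-inject₁ o x r

lookup-∷ʳ-last : ∀ {A : Set} {m} (o : Vec A m) x → lookup (o ∷ʳ x) (fromℕ m) ≡ x
lookup-∷ʳ-last []      x = refl
lookup-∷ʳ-last (y ∷ o) x = lookup-∷ʳ-last o x

replicate-∷ʳ : ∀ {A : Set} n (x : A) → replicate n x ∷ʳ x ≡ replicate (suc n) x
replicate-∷ʳ zero    x = refl
replicate-∷ʳ (suc n) x = cong (x ∷_) (replicate-∷ʳ n x)

vacancies-allVacant : ∀ n → vacancies (replicate n false) ≡ n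
vacancies-allVacant zero    = refl
vacancies-allVacant (suc n) = cong suc (vacancies-allVacant n)

parkCircular : ∀ {n} → Vec Bool n → ℕ → Vec Bool n
parkCircular o a = if proj₂ (parkFrom a o) then proj₁ (parkFrom a o) else proj₁ (parkFrom 0 o)

vacantAfter : ∀ {n} → Vec Bool n → ℕ → Fin n → ℕ
vacantAfter     o zero    r = vacancy (lookup o r)
vacantAfter {n} o (suc k) r = ∑[ a < n ] vacantAfter (parkCircular o (toℕ a)) k r

vacancies-parkCircular : ∀ {n} (o : Vec Bool n) a → vacancies (parkCircular o a) ≡ vacancies o ∸ 1
vacancies-parkCircular o a with proj₂ (parkFrom a o) in ok
... | true = cong (_∸ 1) (parkFrom-success-vacancies a o ok)
... | false with proj₂ (parkFrom 0 o) in ok₀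
...   | true  = cong (_∸ 1) (parkFrom-success-vacancies 0 o ok₀)
...   | false = trans (cong vacancies (parkFrom-failure-unchanged 0 o ok₀))
                      (trans full (cong (_∸ 1) (sym full)))
  where full = parkFrom-zero-failure-full o ok₀

∑-vacantAfter : ∀ {n} (o : Vec Bool n) k → ∑[ r < n ] vacantAfter o k r ≡ (vacancies o ∸ k) * n ^ k
∑-vacantAfter     o zero    = sym (*-identityʳ (vacancies o))
∑-vacantAfter {n} o (suc k) = begin
  ∑[ r < n ] ∑[ a < n ] vacantAfter (parkCircular o (toℕ a)) k r
    ≡⟨ ∑-comm {n} {n} (λ r a → vacantAfter (parkCircular o (toℕ a)) k r) ⟩
  ∑[ a < n ] ∑[ r < n ] vacantAfter (parkCircular o (toℕ a)) k r
    ≡⟨ sum-cong-≗ {n} (λ a → trans (∑-vacantAfter (parkCircular o (toℕ a)) k)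
                                   (cong (λ v → (v ∸ k) * n ^ k) (vacancies-parkCircular o (toℕ a)))) ⟩
  ∑[ a < n ] ((vacancies o ∸ 1 ∸ k) * n ^ k)
    ≡⟨ ∑-const n _ ⟩
  n * ((vacancies o ∸ 1 ∸ k) * n ^ k)
    ≡⟨ cong (λ v → n * (v * n ^ k)) (∸-+-assoc (vacancies o) 1 k) ⟩
  n * ((vacancies o ∸ suc k) * n ^ k)
    ≡⟨ swap n (vacancies o ∸ suc k) (n ^ k) ⟩
  (vacancies o ∸ suc k) * n ^ suc k ∎
  where
  swap : ∀ x y z → x * (y * z) ≡ y * (x * z)
  swap = solve-∀

rotate : ∀ {m} → Vec Bool (suc m) → Vec Bool (suc m)
rotate (b ∷ o) = o ∷ʳ b

rotate-parkFrom-zero : ∀ {m} (o : Vec Bool m) b →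
  rotate (proj₁ (parkFrom 0 (b ∷ o))) ≡ (if not b then o ∷ʳ true else proj₁ (parkFrom 0 (o ∷ʳ b)))
rotate-parkFrom-zero o false = refl
rotate-parkFrom-zero o true rewrite parkFrom-∷ʳ 0 o true z≤n
  with parkFrom 0 o | parkFrom-failure-unchanged 0 o
... | _ , true  | _         = refl
... | _ , false | unchanged = cong (_∷ʳ true) (unchanged refl)

rotate-parkCircular-suc : ∀ {m} (o : Vec Bool m) b a → a < m →
  rotate (parkCircular (b ∷ o) (suc a)) ≡ parkCircular (o ∷ʳ b) a
rotate-parkCircular-suc o b a a<m rewrite parkFrom-∷ʳ a o b (<⇒≤ a<m) with parkFrom a o
... | _ , true  = refl
... | _ , false = rotate-parkFrom-zero o b

rotate-parkCircular-zero : ∀ {m} (o : Vec Bool m) b → rotate (parkCircular (b ∷ o) 0) ≡ parkCircular (o ∷ʳ b) m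
rotate-parkCircular-zero {m} o b rewrite parkFrom-∷ʳ m o b ≤-refl | parkFrom-beyond o m ≤-refl
  with proj₂ (parkFrom 0 (b ∷ o))
... | true  = rotate-parkFrom-zero o b
... | false = rotate-parkFrom-zero o b

vacantAfter-rotate : ∀ {m} (o : Vec Bool (suc m)) k r → vacantAfter (rotate o) k (inject₁ r) ≡ vacantAfter o k (suc r)
vacantAfter-rotate     (b ∷ o) zero    r = cong vacancy (lookup-∷ʳ-inject₁ o b r)
vacantAfter-rotate {m} (b ∷ o) (suc k) r = begin
  ∑[ a < suc m ] vacantAfter (parkCircular (o ∷ʳ b) (toℕ a)) k (inject₁ r)
    ≡⟨ sum-init-last (λ a → vacantAfter (parkCircular (o ∷ʳ b) (toℕ a)) k (inject₁ r)) ⟩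
  ∑[ a < m ] vacantAfter (parkCircular (o ∷ʳ b) (toℕ (inject₁ a))) k (inject₁ r)
    + vacantAfter (parkCircular (o ∷ʳ b) (toℕ (fromℕ m))) k (inject₁ r)
    ≡⟨ cong₂ _+_ (sum-cong-≗ {m} inner) last ⟩
  ∑[ a < m ] vacantAfter (parkCircular (b ∷ o) (suc (toℕ a))) k (suc r)
    + vacantAfter (parkCircular (b ∷ o) 0) k (suc r)
    ≡⟨ +-comm (∑[ a < m ] vacantAfter (parkCircular (b ∷ o) (suc (toℕ a))) k (suc r)) _ ⟩
  ∑[ a < suc m ] vacantAfter (parkCircular (b ∷ o) (toℕ a)) k (suc r) ∎
  where
  inner : ∀ a → vacantAfter (parkCircular (o ∷ʳ b) (toℕ (inject₁ a))) k (inject₁ r)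
              ≡ vacantAfter (parkCircular (b ∷ o) (suc (toℕ a))) k (suc r)
  inner a rewrite toℕ-inject₁ a | sym (rotate-parkCircular-suc o b (toℕ a) (toℕ<n a)) =
    vacantAfter-rotate (parkCircular (b ∷ o) (suc (toℕ a))) k r
  last : vacantAfter (parkCircular (o ∷ʳ b) (toℕ (fromℕ m))) k (inject₁ r) ≡ vacantAfter (parkCircular (b ∷ o) 0) k (suc r)
  last rewrite toℕ-fromℕ m | sym (rotate-parkCircular-zero o b) = vacantAfter-rotate (parkCircular (b ∷ o) 0) k r

vacantAfter-allVacant : ∀ m k r →
  vacantAfter (replicate (suc m) false) k r ≡ vacantAfter (replicate (suc m) false) k zero
vacantAfter-allVacant m k = <-weakInduction (λ r → vacantAfter F k r ≡ vacantAfter F k zero) refl step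
  where
  F = replicate (suc m) false
  step : ∀ i → vacantAfter F k (inject₁ i) ≡ vacantAfter F k zero → vacantAfter F k (suc i) ≡ vacantAfter F k zero
  step i ih = begin
    vacantAfter F k (suc i)             ≡⟨ sym (vacantAfter-rotate F k i) ⟩
    vacantAfter (rotate F) k (inject₁ i) ≡⟨ cong (λ o → vacantAfter o k (inject₁ i)) (replicate-∷ʳ m false) ⟩
    vacantAfter F k (inject₁ i)          ≡⟨ ih ⟩
    vacantAfter F k zero                 ∎

parkCircular-keeps-occupied : ∀ {n} (o : Vec Bool n) a r → lookup o r ≡ true → lookup (parkCircular o a) r ≡ true
parkCircular-keeps-occupied o a r occ with proj₂ (parkFrom a o)
... | true  = parkFrom-keeps-occupied a o r occ
... | false = parkFrom-keeps-occupied 0 o r occ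

vacantAfter-occupied : ∀ {n} (o : Vec Bool n) k r → lookup o r ≡ true → vacantAfter o k r ≡ 0
vacantAfter-occupied     o zero    r occ = cong vacancy occ
vacantAfter-occupied {n} o (suc k) r occ = trans
  (sum-cong-≗ {n} (λ a → vacantAfter-occupied (parkCircular o (toℕ a)) k r (parkCircular-keeps-occupied o (toℕ a) r occ)))
  (trans (∑-const n 0) (*-zeroʳ n))

failCount₀≡vacantAfter-∷ʳ : ∀ {m} (L : Vec Bool m) k → failCount L k 0 ≡ vacantAfter (L ∷ʳ false) k (fromℕ m)
failCount₀≡vacantAfter-∷ʳ     L zero    = sym (cong vacancy (lookup-∷ʳ-last L false))
failCount₀≡vacantAfter-∷ʳ {m} L (suc k) = begin
  ∑[ a < m ] ifParked (λ x → failCount x k 0) 0 (parkFrom (toℕ a) L)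
    ≡⟨ sum-cong-≗ {m} inner ⟩
  ∑[ a < m ] vacantAfter (parkCircular (L ∷ʳ false) (toℕ (inject₁ a))) k (fromℕ m)
    ≡⟨ sym (+-identityʳ _) ⟩
  ∑[ a < m ] vacantAfter (parkCircular (L ∷ʳ false) (toℕ (inject₁ a))) k (fromℕ m) + 0
    ≡⟨ cong (∑[ a < m ] vacantAfter (parkCircular (L ∷ʳ false) (toℕ (inject₁ a))) k (fromℕ m) +_) (sym last) ⟩
  ∑[ a < m ] vacantAfter (parkCircular (L ∷ʳ false) (toℕ (inject₁ a))) k (fromℕ m)
    + vacantAfter (parkCircular (L ∷ʳ false) (toℕ (fromℕ m))) k (fromℕ m)
    ≡⟨ sym (sum-init-last (λ a → vacantAfter (parkCircular (L ∷ʳ false) (toℕ a)) k (fromℕ m))) ⟩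
  ∑[ a < suc m ] vacantAfter (parkCircular (L ∷ʳ false) (toℕ a)) k (fromℕ m) ∎
  where
  lastOccupied : vacantAfter (L ∷ʳ true) k (fromℕ m) ≡ 0
  lastOccupied = vacantAfter-occupied (L ∷ʳ true) k (fromℕ m) (lookup-∷ʳ-last L true)
  inner : ∀ a → ifParked (λ x → failCount x k 0) 0 (parkFrom (toℕ a) L)
              ≡ vacantAfter (parkCircular (L ∷ʳ false) (toℕ (inject₁ a))) k (fromℕ m)
  inner a rewrite toℕ-inject₁ a | parkFrom-∷ʳ (toℕ a) L false (<⇒≤ (toℕ<n a)) with parkFrom (toℕ a) L
  ... | L′ , true  = failCount₀≡vacantAfter-∷ʳ L′ k
  ... | _  , false = sym lastOccupied
  last : vacantAfter (parkCircular (L ∷ʳ false) (toℕ (fromℕ m))) k (fromℕ m) ≡ 0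
  last rewrite toℕ-fromℕ m | parkFrom-∷ʳ m L false ≤-refl | parkFrom-beyond L m ≤-refl = lastOccupied

failCount-allVacant : ∀ m k → suc m * failCount (replicate m false) k 0 ≡ (suc m ∸ k) * suc m ^ k
failCount-allVacant m k = begin
  suc m * failCount (replicate m false) k 0
    ≡⟨ cong (suc m *_) (trans (failCount₀≡vacantAfter-∷ʳ (replicate m false) k)
                              (cong (λ o → vacantAfter o k (fromℕ m)) (replicate-∷ʳ m false))) ⟩
  suc m * vacantAfter F k (fromℕ m)
    ≡⟨ cong (suc m *_) (vacantAfter-allVacant m k (fromℕ m)) ⟩
  suc m * vacantAfter F k zero
    ≡⟨ sym (∑-const (suc m) _) ⟩
  ∑[ r < suc m ] vacantAfter F k zero
    ≡⟨ sum-cong-≗ {suc m} (λ r → sym (vacantAfter-allVacant m k r)) ⟩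
  ∑[ r < suc m ] vacantAfter F k r
    ≡⟨ ∑-vacantAfter F k ⟩
  (vacancies F ∸ k) * suc m ^ k
    ≡⟨ cong (λ v → (v ∸ k) * suc m ^ k) (vacancies-allVacant (suc m)) ⟩
  (suc m ∸ k) * suc m ^ k ∎
  where F = replicate (suc m) false

parkFrom-allVacant-last : ∀ m → parkFrom (suc m) (replicate (suc (suc m)) false) ≡ (replicate m false ∷ʳ false ∷ʳ true , true)
parkFrom-allVacant-last zero    = refl
parkFrom-allVacant-last (suc m) = cong (λ p → false ∷ proj₁ p , proj₂ p) (parkFrom-allVacant-last m)

parkFrom-allVacant-penultimate : ∀ m → parkFrom m (replicate (suc (suc m)) false) ≡ (replicate m false ∷ʳ true ∷ʳ false , true)
parkFrom-allVacant-penultimate zero    = refl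
parkFrom-allVacant-penultimate (suc m) = cong (λ p → false ∷ proj₁ p , proj₂ p) (parkFrom-allVacant-penultimate m)

pOne-last : ∀ m → pOne (suc (suc m)) (fromℕ (suc m)) ≡ failCount (replicate m false ∷ʳ false ∷ʳ true) (suc m) 1
pOne-last m = trans (#failing-∷ F (fromℕ (suc m)) (suc m) 1)
  (cong (ifParked (λ o → failCount o (suc m) 1) (failCount F (suc m) 0))
        (trans (cong (λ a → parkFrom a F) (toℕ-fromℕ (suc m))) (parkFrom-allVacant-last m)))
  where F = replicate (suc (suc m)) false

pOne-penultimate : ∀ m → pOne (suc (suc m)) (inject₁ (fromℕ m)) ≡ failCount (replicate m false ∷ʳ true ∷ʳ false) (suc m) 1
pOne-penultimate m = trans (#failing-∷ F (inject₁ (fromℕ m)) (suc m) 1)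
  (cong (ifParked (λ o → failCount o (suc m) 1) (failCount F (suc m) 0))
        (trans (cong (λ a → parkFrom a F) (trans (toℕ-inject₁ (fromℕ m)) (toℕ-fromℕ m))) (parkFrom-allVacant-penultimate m)))
  where F = replicate (suc (suc m)) false

2*[1+n]C2≡[1+n]*n : ∀ n → 2 * (suc n C 2) ≡ suc n * n
2*[1+n]C2≡[1+n]*n zero    = refl
2*[1+n]C2≡[1+n]*n (suc n) = begin
  2 * (suc (suc n) C 2)        ≡⟨ cong (2 *_) (sym (nCk+nC[k+1]≡[n+1]C[k+1] (suc n) 1)) ⟩
  2 * (suc n C 1 + suc n C 2)  ≡⟨ cong (λ c → 2 * (c + suc n C 2)) (nC1≡n (suc n)) ⟩
  2 * (suc n + suc n C 2)      ≡⟨ *-distribˡ-+ 2 (suc n) (suc n C 2) ⟩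
  2 * suc n + 2 * (suc n C 2)  ≡⟨ cong (2 * suc n +_) (2*[1+n]C2≡[1+n]*n n) ⟩
  2 * suc n + suc n * n        ≡⟨ expand n ⟨
  suc (suc n) * suc n          ∎
  where
  expand : ∀ n → suc (suc n) * suc n ≡ 2 * suc n + suc n * n
  expand = solve-∀

failCount-allVacant-ratio : ∀ m →
  m * failCount (replicate m false) m 0 ≡ (suc m C 2) * failCount (replicate m false) (m ∸ 1) 0
failCount-allVacant-ratio zero    = refl
failCount-allVacant-ratio (suc m) = *-cancelˡ-≡ _ _ N (begin
  N * (suc m * Z₁)                   ≡⟨ x*[y*z]≡y*[x*z] N (suc m) Z₁ ⟩
  suc m * (N * Z₁)                   ≡⟨ cong (suc m *_) (failCount-allVacant (suc m) (suc m)) ⟩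
  suc m * ((N ∸ suc m) * N ^ suc m)  ≡⟨ cong (λ c → suc m * (c * N ^ suc m)) (m+n∸n≡m 1 (suc m)) ⟩
  suc m * (1 * N ^ suc m)            ≡⟨ regroupˡ (suc m) N (N ^ m) ⟩
  N * suc m * N ^ m                  ≡⟨ cong (_* N ^ m) (2*[1+n]C2≡[1+n]*n (suc m)) ⟨
  2 * (N C 2) * N ^ m                ≡⟨ regroupʳ (N C 2) (N ^ m) ⟩
  (N C 2) * (2 * N ^ m)              ≡⟨ cong (λ c → (N C 2) * (c * N ^ m)) (m+n∸n≡m 2 m) ⟨
  (N C 2) * ((N ∸ m) * N ^ m)        ≡⟨ cong ((N C 2) *_) (failCount-allVacant (suc m) m) ⟨
  (N C 2) * (N * Z₀)                 ≡⟨ x*[y*z]≡y*[x*z] (N C 2) N Z₀ ⟩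
  N * ((N C 2) * Z₀)                 ∎)
  where
  N  = suc (suc m)
  Z₁ = failCount (replicate (suc m) false) (suc m) 0
  Z₀ = failCount (replicate (suc m) false) m 0
  x*[y*z]≡y*[x*z] : ∀ x y z → x * (y * z) ≡ y * (x * z)
  x*[y*z]≡y*[x*z] = solve-∀
  regroupˡ : ∀ a n p → a * (1 * (n * p)) ≡ n * a * p
  regroupˡ = solve-∀
  regroupʳ : ∀ c p → 2 * c * p ≡ c * (2 * p)
  regroupʳ = solve-∀

marked-allVacant : ∀ m → let F = replicate m false in
  marked F (suc m) 1 ≡ marked F (suc m) 2 + failCount F m 0
marked-allVacant m = begin
  marked F (suc m) 1                     ≡⟨ marked≡C*failCount F (suc m) 1 ⟩
  (suc m C 1) * failCount F m 0          ≡⟨ cong (_* failCount F m 0) (nC1≡n (suc m)) ⟩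
  failCount F m 0 + m * failCount F m 0  ≡⟨ cong (failCount F m 0 +_) (failCount-allVacant-ratio m) ⟩
  failCount F m 0 + (suc m C 2) * failCount F (m ∸ 1) 0
    ≡⟨ +-comm (failCount F m 0) _ ⟩
  (suc m C 2) * failCount F (m ∸ 1) 0 + failCount F m 0
    ≡⟨ cong (_+ failCount F m 0) (marked≡C*failCount F (suc m) 2) ⟨
  marked F (suc m) 2 + failCount F m 0   ∎
  where F = replicate m false

lemma6p1 : (m : ℕ) →
    pOne (suc (suc m)) (fromℕ (suc m))
    ≡ pOne (suc (suc m)) (inject₁ (fromℕ m)) + parkingFunctions m
lemma6p1 m = +-cancelʳ-≡ (marked F (suc m) 2) _ _ (begin
  pOne (suc (suc m)) (fromℕ (suc m)) + marked F (suc m) 2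
    ≡⟨ cong (_+ marked F (suc m) 2) (pOne-last m) ⟩
  failCount (F ∷ʳ false ∷ʳ true) (suc m) 1 + marked F (suc m) 2
    ≡⟨ failCount-swap-last-two₁ F (suc m) ⟩
  failCount (F ∷ʳ true ∷ʳ false) (suc m) 1 + marked F (suc m) 1
    ≡⟨ cong₂ _+_ (sym (pOne-penultimate m)) (marked-allVacant m) ⟩
  pOne (suc (suc m)) (inject₁ (fromℕ m)) + (marked F (suc m) 2 + failCount F m 0)
    ≡⟨ cong (λ z → pOne (suc (suc m)) (inject₁ (fromℕ m)) + (marked F (suc m) 2 + z)) (sym (#failing≡failCount F m 0)) ⟩
  pOne (suc (suc m)) (inject₁ (fromℕ m)) + (marked F (suc m) 2 + parkingFunctions m)
    ≡⟨ cong (pOne (suc (suc m)) (inject₁ (fromℕ m)) +_) (+-comm (marked F (suc m) 2) (parkingFunctions m)) ⟩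
  pOne (suc (suc m)) (inject₁ (fromℕ m)) + (parkingFunctions m + marked F (suc m) 2)
    ≡⟨ +-assoc (pOne (suc (suc m)) (inject₁ (fromℕ m))) (parkingFunctions m) (marked F (suc m) 2) ⟨
  pOne (suc (suc m)) (inject₁ (fromℕ m)) + parkingFunctions m + marked F (suc m) 2 ∎)
  where F = replicate m false
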